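{- Let $t,t'$ be resource $\lambda\mu$-terms and $\mathcal T$ a sum. If $t\to_{\mu^r}t'+\mathcal T$, then $\mathrm{ms}(t)>\mathrm{ms}(t')$ in the multiset order.
   Context: Resource $\lambda\mu$-terms (over disjoint countable sets of variables and names) are generated by $t::=x\mid\lambda x.t\mid t[t_1,\dots,t_n]\mid\mu\alpha.{}_\beta|t|$. - Bags $[t_1,\dots,t_n]$ are finite multisets; $1$ is the empty bag and $*$ is union. - Sums are finite sets of resource terms with idempotent $+$. - A weak composition (w.c.) of a bag $B$ is a tuple of possibly empty bags whose union is $B$. Linear named application $\langle t\rangle_\alpha B$: - $\langle x\rangle_\alpha1=x$, and $\langle x\rangle_\alpha B=0$ if $B\ne1$. - It commutes with $\lambda y$, and $\langle\mu\gamma.{}_\eta|t|\rangle_\alpha B=\mu\gamma.\langle{}_\eta|t|\rangle_\alpha B$. - $\langle{}_\eta|t|\rangle_\alpha B={}_\eta|\langle t\rangle_\alpha B|$ ($\eta\ne\alpha$), and $\langle{}_\alpha|t|\rangle_\alpha B=\sum_{(B_1,B_2)\text{ w.c. of }B}{}_\alpha|(\langle t\rangle_\alpha B_1)B_2|$. - $\langle t[v_1..v_n]\rangle_\alpha B=\sum_{(B_0..B_n)\text{ w.c. of }B}(\langle t\rangle_\alpha B_0)[\langle v_1\rangle_\alpha B_1,\dots,\langle v_n\rangle_\alpha B_n]$. - Constructors extend multilinearly to sums. The reduction $\to_{\mu^r}$ is the closure under single-hole resource contexts $c$ of the rule $(\mu\alpha.{}_\beta|s|)B\to\mu\alpha.\langle{}_\beta|s|\rangle_\alpha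 B$; thus $c[(\mu\alpha.{}_\beta|s|)B]\to_{\mu^r}c[\mu\alpha.\langle{}_\beta|s|\rangle_\alpha B]$ (extended multilinearly). Measure. - $\deg_\mu(t)$ is the number of $\mu$-abstractions of $t$. - For an occurrence $b$ of a bag in $t$, $d_t(b)$ is the number of named subterms ${}_\beta|s|$ of $t$ containing $b$. - $\mathrm{ms}(t):=[\deg_\mu(t)-d_t(b)\mid b\text{ occurrence of a bag in }t]$, a finite multiset of natural numbers, ordered by the multiset order induced by $<$ on $\mathbb N$. -}

module Defs where

open import Data.Nat using (ℕ; zero; suc; _∸_; _<_; _<ᵇ_; _≡ᵇ_; _+_)
open import Data.Bool using (Bool; true; false; if_then_else_)
open import Data.List using (List; []; _∷_; _++_; map; concatMap; length)
open import Data.List.Membership.Propositional using (_∈_)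
open import Data.List.Relation.Binary.Permutation.Propositional using (_↭_)
open import Data.Product using (_×_; _,_; ∃; ∃-syntax; Σ-syntax; uncurry)
open import Relation.Binary.PropositionalEquality using (_≢_)

-- Resource λμ-terms, de Bruijn style (for both variables and names).
--   var x        : the variable with index x
--   lam t        : λ.t
--   app t B      : t B, with the bag B represented as a list (multiset
--                  up to permutation)
--   mu β t       : μα.β|t|  (α is the binder, de Bruijn name index 0 in t;
--                  β is a name index in the scope *inside* the μ)

data Term : Set where
  var : ℕ → Term
  lam : Term → Term
  app : Term → List Term → Term
  mu  : ℕ → Term → Term

Bag : Set
Bag = List Term

-- A sum is a finite set of terms, represented by a list (membership = set).
Sum : Set
Sum = List Term

mutual
  shiftV : ℕ → Term → Term
  shiftV c (var x)   = var (if x <ᵇ c then x else suc x)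
  shiftV c (lam t)   = lam (shiftV (suc c) t)
  shiftV c (app t B) = app (shiftV c t) (shiftVs c B)
  shiftV c (mu β t)  = mu β (shiftV c t)

  shiftVs : ℕ → List Term → List Term
  shiftVs c []      = []
  shiftVs c (t ∷ B) = shiftV c t ∷ shiftVs c B

mutual
  shiftN : ℕ → Term → Term
  shiftN c (var x)   = var x
  shiftN c (lam t)   = lam (shiftN c t)
  shiftN c (app t B) = app (shiftN c t) (shiftNs c B)
  shiftN c (mu β t)  = mu (if β <ᵇ suc c then β else suc β) (shiftN (suc c) t)

  shiftNs : ℕ → List Term → List Term
  shiftNs c []      = []
  shiftNs c (t ∷ B) = shiftN c t ∷ shiftNs c B

-- all pairs (B₁ , B₂) with B₁ * B₂ = B
wc2 : {A : Set} → List A → List (List A × List A)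
wc2 []       = ([] , []) ∷ []
wc2 (x ∷ xs) = concatMap (λ p → let l = Data.Product.proj₁ p ; r = Data.Product.proj₂ p in
                                 (x ∷ l , r) ∷ (l , x ∷ r) ∷ []) (wc2 xs)

-- all k-tuples (B₁ , … , Bₖ) (as lists of length k) with B₁ * … * Bₖ = B
wcN : {A : Set} → ℕ → List A → List (List (List A))
wcN zero    []      = [] ∷ []
wcN zero    (_ ∷ _) = []
wcN (suc k) B       = concatMap (λ p → map (Data.Product.proj₁ p ∷_) (wcN k (Data.Product.proj₂ p))) (wc2 B)

-- Linear named application ⟨t⟩_α B  (α a de Bruijn name index)

mutual
  lin : Term → ℕ → Bag → Sum
  lin (var x)    α []      = var x ∷ []
  lin (var x)    α (_ ∷ _) = []
  lin (lam t)    α B       = map lam (lin t α (shiftVs 0 B))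
  lin (mu η t)   α B       = map (uncurry mu) (linNamed η t (suc α) (shiftNs 0 B))
  lin (app t vs) α B       = linAppAll t vs α (wcN (suc (length vs)) B)

  -- ⟨ η|t| ⟩_α B, a sum of named terms (name , body)
  linNamed : ℕ → Term → ℕ → Bag → List (ℕ × Term)
  linNamed η t α B with η ≡ᵇ α
  ... | true  = linNamedSplit t α (wc2 B)
  ... | false = map (η ,_) (lin t α B)

  linNamedSplit : Term → ℕ → List (Bag × Bag) → List (ℕ × Term)
  linNamedSplit t α []                 = []
  linNamedSplit t α ((B₁ , B₂) ∷ rest) =
    map (λ u → α , app u B₂) (lin t α B₁) ++ linNamedSplit t α rest

  linAppAll : Term → List Term → ℕ → List (List Bag) → Sum
  linAppAll t vs α []          = []
  linAppAll t vs α (Bs ∷ rest) = linApp t vs α Bs ++ linAppAll t vs α rest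

  linApp : Term → List Term → ℕ → List Bag → Sum
  linApp t vs α []        = []
  linApp t vs α (B₀ ∷ Bs) = linAppHead (lin t α B₀) (linBag vs α Bs)

  linBag : List Term → ℕ → List Bag → List Bag
  linBag []       α []        = [] ∷ []
  linBag []       α (_ ∷ _)   = []
  linBag (_ ∷ _)  α []        = []
  linBag (v ∷ vs) α (B ∷ Bs)  = cons* (lin v α B) (linBag vs α Bs)

  cons* : List Term → List Bag → List Bag
  cons* []       bs = []
  cons* (u ∷ us) bs = map (u ∷_) bs ++ cons* us bs

  linAppHead : List Term → List Bag → Sum
  linAppHead []       bs = []
  linAppHead (u ∷ us) bs = map (app u) bs ++ linAppHead us bs

-- The reduction →_{μ^r}: a term reduces to a sum.
-- Single-hole resource contexts: [·] | λ.c | c B | t ([c] * B) | μα.β|c|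
-- (the hole in a bag may be at any position, bags being multisets).

data _⟶μr_ : Term → Sum → Set where
  root : ∀ β s B →
         app (mu β s) B ⟶μr map (uncurry mu) (linNamed β s 0 (shiftNs 0 B))
  lamC : ∀ {t S} → t ⟶μr S → lam t ⟶μr map lam S
  appL : ∀ {t S} B → t ⟶μr S → app t B ⟶μr map (λ u → app u B) S
  appR : ∀ {u S} t B₁ B₂ → u ⟶μr S →
         app t (B₁ ++ u ∷ B₂) ⟶μr map (λ u' → app t (B₁ ++ u' ∷ B₂)) S
  muC  : ∀ {t S} β → t ⟶μr S → mu β t ⟶μr map (mu β) S

mutual
  degμ : Term → ℕ
  degμ (var x)   = 0
  degμ (lam t)   = degμ t
  degμ (app t B) = degμ t + degμs B
  degμ (mu β t)  = suc (degμ t)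

  degμs : List Term → ℕ
  degμs []      = 0
  degμs (t ∷ B) = degμ t + degμs B

-- for every bag occurrence b in t: d_t(b), the number of named
-- subterms (i.e. bodies of μ's) containing b
mutual
  bagDepths : Term → List ℕ
  bagDepths (var x)   = []
  bagDepths (lam t)   = bagDepths t
  bagDepths (app t B) = 0 ∷ (bagDepths t ++ bagDepthss B)
  bagDepths (mu β t)  = map suc (bagDepths t)

  bagDepthss : List Term → List ℕ
  bagDepthss []      = []
  bagDepthss (t ∷ B) = bagDepths t ++ bagDepthss B

ms : Term → List ℕ
ms t = map (degμ t ∸_) (bagDepths t)

-- Multiset order (Dershowitz–Manna) on finite multisets of ℕ,
-- multisets represented as lists up to permutation:
-- M <ₘ N iff M = Z + Y, N = Z + X, X ≠ ∅, and every y ∈ Y is < some x ∈ X.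

_<ₘ_ : List ℕ → List ℕ → Set
M <ₘ N = ∃[ X ] ∃[ Y ] ∃[ Z ]
           ((M ↭ Z ++ Y) × (N ↭ Z ++ X) × (X ≢ []) ×
            (∀ {y} → y ∈ Y → ∃[ x ] (x ∈ X × y < x)))

-- A μ^r-step neither creates nor erases μ-abstractions, so deg_μ is invariant; as
-- depths never exceed deg_μ, ms t' < ms t amounts to the multiset of depths d(b)
-- growing in the dual Dershowitz–Manna order. Firing (μα.β|s|)B erases the bag B
-- and the bags inside it, all at depth at least that of B; every other bag of a
-- summand is either a bag of s, kept at its depth by linear named application, or
-- lies in the body of μα and is therefore strictly deeper than B.
module Submission where

open import Defs
open import Data.Bool using (true; false)
open import Data.Empty using (⊥-elim)
open import Data.List using (List; []; _∷_; _++_; [_]; map; concat; length)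
open import Data.List.Properties using (map-++; ++-identityʳ)
open import Data.List.Membership.Propositional using (_∈_; find)
open import Data.List.Membership.Propositional.Properties using (∈-map⁻; ∈-map⁺; ∈-++⁻; ∈-++⁺ʳ; ∈-concatMap⁻)
open import Data.List.Relation.Unary.Any using (here; there)
import Data.List.Relation.Binary.Permutation.Propositional as ↭
open import Data.List.Relation.Binary.Permutation.Propositional using (_↭_; ↭-refl; ↭-sym; ↭-trans; ↭-reflexive)
open import Data.List.Relation.Binary.Permutation.Propositional.Properties using (++⁺; ++⁺ˡ; ++⁺ʳ; ++-assoc; ++-comm; map⁺; shift; shifts; ∈-resp-↭)
open import Data.Nat using (ℕ; zero; suc; _+_; _∸_; _≡ᵇ_; _≤_; _<_; _>_; z≤n; s≤s)
open import Data.Nat.Properties using (+-assoc; +-commutativeSemigroup; ≤-trans; m≤m+n; m≤n+m; ∸-monoʳ-<)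
open import Algebra.Properties.CommutativeSemigroup +-commutativeSemigroup using (interchange; x∙yz≈y∙xz)
open import Data.Product using (_×_; _,_; ∃-syntax; uncurry)
open import Data.Sum using (_⊎_; inj₁; inj₂)
open import Relation.Binary.PropositionalEquality using (_≡_; _≢_; refl; sym; trans; cong; cong₂; subst; module ≡-Reasoning)

-- Dershowitz–Manna order; `MultisetLt _<_` unfolds to `_<ₘ_`.
MultisetLt : {A : Set} → (A → A → Set) → List A → List A → Set
MultisetLt _≺_ M N = ∃[ X ] ∃[ Y ] ∃[ Z ]
  ((M ↭ Z ++ Y) × (N ↭ Z ++ X) × (X ≢ []) × (∀ {y} → y ∈ Y → ∃[ x ] (x ∈ X × y ≺ x)))

module _ {A : Set} {_≺_ : A → A → Set} where

  multisetLt-resp-↭ : ∀ {M M′ N N′} → M ↭ M′ → N ↭ N′ →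
                      MultisetLt _≺_ M N → MultisetLt _≺_ M′ N′
  multisetLt-resp-↭ M↭M′ N↭N′ (X , Y , Z , M↭ , N↭ , dominated) =
    X , Y , Z , ↭-trans (↭-sym M↭M′) M↭ , ↭-trans (↭-sym N↭N′) N↭ , dominated

  multisetLt-++ˡ : ∀ P {M N} → MultisetLt _≺_ M N → MultisetLt _≺_ (P ++ M) (P ++ N)
  multisetLt-++ˡ P (X , Y , Z , M↭ , N↭ , dominated) =
    X , Y , P ++ Z ,
    ↭-trans (++⁺ˡ P M↭) (↭-sym (++-assoc P Z Y)) ,
    ↭-trans (++⁺ˡ P N↭) (↭-sym (++-assoc P Z X)) , dominated

  multisetLt-++ʳ : ∀ Q {M N} → MultisetLt _≺_ M N → MultisetLt _≺_ (M ++ Q) (N ++ Q)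
  multisetLt-++ʳ Q {M} {N} M<N =
    multisetLt-resp-↭ (++-comm Q M) (++-comm Q N) (multisetLt-++ˡ Q M<N)

multisetLt-map : {A B : Set} {_≺_ : A → A → Set} {_⊏_ : B → B → Set} (f : A → B) {M N : List A} →
                 (∀ {x y} → y ∈ M → y ≺ x → f y ⊏ f x) →
                 MultisetLt _≺_ M N → MultisetLt _⊏_ (map f M) (map f N)
multisetLt-map {_⊏_ = _⊏_} f mono (X , Y , Z , M↭ , N↭ , X≢[] , dominated) =
  map f X , map f Y , map f Z ,
  ↭-trans (map⁺ f M↭) (↭-reflexive (map-++ f Z Y)) ,
  ↭-trans (map⁺ f N↭) (↭-reflexive (map-++ f Z X)) ,
  map-≢[] X X≢[] , dominated′
  where
  map-≢[] : ∀ X → X ≢ [] → map f X ≢ []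
  map-≢[] []      X≢[] = ⊥-elim (X≢[] refl)
  map-≢[] (_ ∷ _) _    = λ ()

  dominated′ : ∀ {fy} → fy ∈ map f Y → ∃[ fx ] (fx ∈ map f X × fy ⊏ fx)
  dominated′ fy∈ with ∈-map⁻ f fy∈
  ... | y , y∈Y , refl with dominated y∈Y
  ...   | x , x∈X , y≺x = f x , ∈-map⁺ f x∈X , mono (∈-resp-↭ (↭-sym M↭) (∈-++⁺ʳ Z y∈Y)) y≺x

infix 4 _⊆ₘ_

_⊆ₘ_ : {A : Set} → List A → List A → Set
L ⊆ₘ M = ∃[ Y ] (M ↭ L ++ Y)

module _ {A : Set} where

  ⊆ₘ-refl : {L : List A} → L ⊆ₘ L
  ⊆ₘ-refl {L} = [] , ↭-reflexive (sym (++-identityʳ L))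

  ⊆ₘ-∷⁺ : ∀ {L M : List A} x → L ⊆ₘ M → x ∷ L ⊆ₘ x ∷ M
  ⊆ₘ-∷⁺ x (Y , p) = Y , ↭.prep x p

  ⊆ₘ-∷ʳ : ∀ {L M : List A} x → L ⊆ₘ M → L ⊆ₘ x ∷ M
  ⊆ₘ-∷ʳ {L} x (Y , p) = x ∷ Y , ↭-trans (↭.prep x p) (↭-sym (shift x L Y))

  ⊆ₘ-++ʳ : ∀ {L M : List A} N → L ⊆ₘ M → L ⊆ₘ M ++ N
  ⊆ₘ-++ʳ {L} N (Y , p) = Y ++ N , ↭-trans (++⁺ʳ N p) (++-assoc L Y N)

  ⊆ₘ-++⁺ : ∀ {L M L′ M′ : List A} → L ⊆ₘ M → L′ ⊆ₘ M′ → L ++ L′ ⊆ₘ M ++ M′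
  ⊆ₘ-++⁺ {L} {M} {L′} {M′} (Y , p) (Y′ , p′) = Y ++ Y′ , (begin
    M ++ M′                   ↭⟨ ++⁺ p p′ ⟩
    (L ++ Y) ++ (L′ ++ Y′)    ↭⟨ ++-assoc L Y (L′ ++ Y′) ⟩
    L ++ (Y ++ (L′ ++ Y′))    ↭⟨ ++⁺ˡ L (shifts Y L′) ⟩
    L ++ (L′ ++ (Y ++ Y′))    ↭⟨ ++-assoc L L′ (Y ++ Y′) ⟨
    (L ++ L′) ++ (Y ++ Y′)    ∎)
    where open ↭.PermutationReasoning

⊆ₘ-map : {A B : Set} {L M : List A} (f : A → B) → L ⊆ₘ M → map f L ⊆ₘ map f M
⊆ₘ-map {L = L} f (Y , p) = map f Y , ↭-trans (map⁺ f p) (↭-reflexive (map-++ f L Y))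

wc2-↭ : {A : Set} (xs : List A) {l r : List A} → (l , r) ∈ wc2 xs → xs ↭ l ++ r
wc2-↭ []       (here refl) = ↭-refl
wc2-↭ []       (there ())
wc2-↭ (x ∷ xs) lr∈ with find (∈-concatMap⁻ _ {xs = wc2 xs} lr∈)
... | _       , lr∈′ , here refl         = ↭.prep x (wc2-↭ xs lr∈′)
... | (l , r) , lr∈′ , there (here refl) = ↭-trans (↭.prep x (wc2-↭ xs lr∈′)) (↭-sym (shift x l r))
... | _       , _    , there (there ())

wcN-↭ : {A : Set} (k : ℕ) (xs : List A) {Bs : List (List A)} → Bs ∈ wcN k xs → xs ↭ concat Bs
wcN-↭ zero    []      (here refl) = ↭-refl
wcN-↭ zero    []      (there ())
wcN-↭ zero    (_ ∷ _) ()
wcN-↭ (suc k) xs      Bs∈ with find (∈-concatMap⁻ _ {xs = wc2 xs} Bs∈)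
... | (l , r) , lr∈ , Bs∈′ with ∈-map⁻ (l ∷_) Bs∈′
...   | _ , Bs′∈ , refl = ↭-trans (wc2-↭ xs lr∈) (++⁺ˡ l (wcN-↭ k r Bs′∈))

mutual
  degμ-shiftV : ∀ c t → degμ (shiftV c t) ≡ degμ t
  degμ-shiftV c (var x)   = refl
  degμ-shiftV c (lam t)   = degμ-shiftV (suc c) t
  degμ-shiftV c (app t B) = cong₂ _+_ (degμ-shiftV c t) (degμs-shiftVs c B)
  degμ-shiftV c (mu β t)  = cong suc (degμ-shiftV c t)

  degμs-shiftVs : ∀ c B → degμs (shiftVs c B) ≡ degμs B
  degμs-shiftVs c []      = refl
  degμs-shiftVs c (t ∷ B) = cong₂ _+_ (degμ-shiftV c t) (degμs-shiftVs c B)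

mutual
  degμ-shiftN : ∀ c t → degμ (shiftN c t) ≡ degμ t
  degμ-shiftN c (var x)   = refl
  degμ-shiftN c (lam t)   = degμ-shiftN c t
  degμ-shiftN c (app t B) = cong₂ _+_ (degμ-shiftN c t) (degμs-shiftNs c B)
  degμ-shiftN c (mu β t)  = cong suc (degμ-shiftN (suc c) t)

  degμs-shiftNs : ∀ c B → degμs (shiftNs c B) ≡ degμs B
  degμs-shiftNs c []      = refl
  degμs-shiftNs c (t ∷ B) = cong₂ _+_ (degμ-shiftN c t) (degμs-shiftNs c B)

degμs-++ : ∀ B C → degμs (B ++ C) ≡ degμs B + degμs C
degμs-++ []      C = refl
degμs-++ (t ∷ B) C = trans (cong (degμ t +_) (degμs-++ B C)) (sym (+-assoc (degμ t) (degμs B) (degμs C)))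

degμs-↭ : ∀ {B C} → B ↭ C → degμs B ≡ degμs C
degμs-↭ ↭.refl         = refl
degμs-↭ (↭.prep t p)   = cong (degμ t +_) (degμs-↭ p)
degμs-↭ (↭.swap t u p) = trans (x∙yz≈y∙xz (degμ t) (degμ u) _) (cong (λ d → degμ u + (degμ t + d)) (degμs-↭ p))
degμs-↭ (↭.trans p q)  = trans (degμs-↭ p) (degμs-↭ q)

degμs-++-∷ : ∀ B₁ {u u′} B₂ → degμ u′ ≡ degμ u → degμs (B₁ ++ u′ ∷ B₂) ≡ degμs (B₁ ++ u ∷ B₂)
degμs-++-∷ []       B₂ eq = cong (_+ degμs B₂) eq
degμs-++-∷ (t ∷ B₁) B₂ eq = cong (degμ t +_) (degμs-++-∷ B₁ B₂ eq)

bagDepthss-++-∷ : {_≺_ : ℕ → ℕ → Set} → ∀ B₁ {u u′} B₂ →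
                  MultisetLt _≺_ (bagDepths u′) (bagDepths u) →
                  MultisetLt _≺_ (bagDepthss (B₁ ++ u′ ∷ B₂)) (bagDepthss (B₁ ++ u ∷ B₂))
bagDepthss-++-∷ []       B₂ lt = multisetLt-++ʳ (bagDepthss B₂) lt
bagDepthss-++-∷ (t ∷ B₁) B₂ lt = multisetLt-++ˡ (bagDepths t) (bagDepthss-++-∷ B₁ B₂ lt)

mutual
  bagDepths-≤-degμ : ∀ t {d} → d ∈ bagDepths t → d ≤ degμ t
  bagDepths-≤-degμ (lam t)   d∈          = bagDepths-≤-degμ t d∈
  bagDepths-≤-degμ (app t B) (here refl) = z≤n
  bagDepths-≤-degμ (app t B) (there d∈) with ∈-++⁻ (bagDepths t) d∈
  ... | inj₁ d∈t = ≤-trans (bagDepths-≤-degμ t d∈t) (m≤m+n _ _)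
  ... | inj₂ d∈B = ≤-trans (bagDepthss-≤-degμs B d∈B) (m≤n+m _ _)
  bagDepths-≤-degμ (mu β t)  d∈ with ∈-map⁻ suc d∈
  ... | _ , d∈t , refl = s≤s (bagDepths-≤-degμ t d∈t)

  bagDepthss-≤-degμs : ∀ B {d} → d ∈ bagDepthss B → d ≤ degμs B
  bagDepthss-≤-degμs (t ∷ B) d∈ with ∈-++⁻ (bagDepths t) d∈
  ... | inj₁ d∈t = ≤-trans (bagDepths-≤-degμ t d∈t) (m≤m+n _ _)
  ... | inj₂ d∈B = ≤-trans (bagDepthss-≤-degμs B d∈B) (m≤n+m _ _)

∈-linAppHead⁻ : ∀ us bs {w} → w ∈ linAppHead us bs → ∃[ u ] ∃[ b ] (u ∈ us × b ∈ bs × w ≡ app u b)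
∈-linAppHead⁻ (u ∷ us) bs w∈ with ∈-++⁻ (map (app u) bs) w∈
... | inj₁ w∈head with ∈-map⁻ (app u) w∈head
...   | b , b∈ , eq = u , b , here refl , b∈ , eq
∈-linAppHead⁻ (u ∷ us) bs w∈ | inj₂ w∈tail with ∈-linAppHead⁻ us bs w∈tail
...   | u′ , b , u′∈ , b∈ , eq = u′ , b , there u′∈ , b∈ , eq

∈-cons*⁻ : ∀ us bs {c} → c ∈ cons* us bs → ∃[ u ] ∃[ b ] (u ∈ us × b ∈ bs × c ≡ u ∷ b)
∈-cons*⁻ (u ∷ us) bs c∈ with ∈-++⁻ (map (u ∷_) bs) c∈
... | inj₁ c∈head with ∈-map⁻ (u ∷_) c∈head
...   | b , b∈ , eq = u , b , here refl , b∈ , eq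
∈-cons*⁻ (u ∷ us) bs c∈ | inj₂ c∈tail with ∈-cons*⁻ us bs c∈tail
...   | u′ , b , u′∈ , b∈ , eq = u′ , b , there u′∈ , b∈ , eq

∈-linAppAll⁻ : ∀ t vs α Bss {w} → w ∈ linAppAll t vs α Bss → ∃[ Bs ] (Bs ∈ Bss × w ∈ linApp t vs α Bs)
∈-linAppAll⁻ t vs α (Bs ∷ Bss) w∈ with ∈-++⁻ (linApp t vs α Bs) w∈
... | inj₁ w∈Bs = Bs , here refl , w∈Bs
... | inj₂ w∈rest with ∈-linAppAll⁻ t vs α Bss w∈rest
...   | Bs′ , Bs′∈ , w∈Bs′ = Bs′ , there Bs′∈ , w∈Bs′

∈-lin-app⁻ : ∀ t vs α B {w} → w ∈ lin (app t vs) α B →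
             ∃[ B₀ ] ∃[ Bs ] ∃[ u ] ∃[ b ]
               (B ↭ B₀ ++ concat Bs × u ∈ lin t α B₀ × b ∈ linBag vs α Bs × w ≡ app u b)
∈-lin-app⁻ t vs α B w∈ with ∈-linAppAll⁻ t vs α (wcN (suc (length vs)) B) w∈
... | B₀ ∷ Bs , Bs∈ , w∈′ with ∈-linAppHead⁻ (lin t α B₀) (linBag vs α Bs) w∈′
...   | u , b , u∈ , b∈ , eq = B₀ , Bs , u , b , wcN-↭ (suc (length vs)) B Bs∈ , u∈ , b∈ , eq

∈-linNamedSplit⁻ : ∀ t α Ps {η w} → (η , w) ∈ linNamedSplit t α Ps →
                   ∃[ B₁ ] ∃[ B₂ ] ∃[ u ] ((B₁ , B₂) ∈ Ps × u ∈ lin t α B₁ × w ≡ app u B₂)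
∈-linNamedSplit⁻ t α ((B₁ , B₂) ∷ Ps) p∈ with ∈-++⁻ (map (λ u → α , app u B₂) (lin t α B₁)) p∈
... | inj₁ p∈head with ∈-map⁻ (λ u → α , app u B₂) p∈head
...   | u , u∈ , refl = B₁ , B₂ , u , here refl , u∈ , refl
∈-linNamedSplit⁻ t α (_ ∷ Ps) p∈ | inj₂ p∈tail with ∈-linNamedSplit⁻ t α Ps p∈tail
...   | B₁ , B₂ , u , B₁₂∈ , u∈ , eq = B₁ , B₂ , u , there B₁₂∈ , u∈ , eq

∈-linNamed⁻ : ∀ η t α B {η′ w} → (η′ , w) ∈ linNamed η t α B →
              w ∈ lin t α B ⊎ ∃[ B₁ ] ∃[ B₂ ] ∃[ u ] (B ↭ B₁ ++ B₂ × u ∈ lin t α B₁ × w ≡ app u B₂)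
∈-linNamed⁻ η t α B p∈ with η ≡ᵇ α
... | true with ∈-linNamedSplit⁻ t α (wc2 B) p∈
...   | B₁ , B₂ , u , B₁₂∈ , u∈ , eq = inj₂ (B₁ , B₂ , u , wc2-↭ B B₁₂∈ , u∈ , eq)
∈-linNamed⁻ η t α B p∈ | false with ∈-map⁻ (η ,_) p∈
...   | _ , w∈ , refl = inj₁ w∈

mutual
  degμ-lin : ∀ t α B {w} → w ∈ lin t α B → degμ w ≡ degμ t + degμs B
  degμ-lin (var x) α [] (here refl) = refl
  degμ-lin (var x) α [] (there ())
  degμ-lin (lam t) α B w∈ with ∈-map⁻ lam w∈
  ... | _ , w∈′ , refl = trans (degμ-lin t α _ w∈′) (cong (degμ t +_) (degμs-shiftVs 0 B))
  degμ-lin (mu η t) α B w∈ with ∈-map⁻ (uncurry mu) w∈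
  ... | _ , p∈ , refl =
    cong suc (trans (degμ-linNamed η t (suc α) _ p∈) (cong (degμ t +_) (degμs-shiftNs 0 B)))
  degμ-lin (app t vs) α B w∈ with ∈-lin-app⁻ t vs α B w∈
  ... | B₀ , Bs , u , b , B↭ , u∈ , b∈ , refl = begin
    degμ u + degμs b                                        ≡⟨ cong₂ _+_ (degμ-lin t α B₀ u∈) (degμs-linBag vs α Bs b∈) ⟩
    (degμ t + degμs B₀) + (degμs vs + degμs (concat Bs))    ≡⟨ interchange (degμ t) _ _ _ ⟩
    (degμ t + degμs vs) + (degμs B₀ + degμs (concat Bs))    ≡⟨ cong (degμ t + degμs vs +_) (degμs-++ B₀ (concat Bs)) ⟨
    (degμ t + degμs vs) + degμs (B₀ ++ concat Bs)           ≡⟨ cong (degμ t + degμs vs +_) (degμs-↭ B↭) ⟨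
    (degμ t + degμs vs) + degμs B                           ∎
    where open ≡-Reasoning

  degμ-linNamed : ∀ η t α B {η′ w} → (η′ , w) ∈ linNamed η t α B → degμ w ≡ degμ t + degμs B
  degμ-linNamed η t α B p∈ with ∈-linNamed⁻ η t α B p∈
  ... | inj₁ w∈ = degμ-lin t α B w∈
  ... | inj₂ (B₁ , B₂ , u , B↭ , u∈ , refl) = begin
    degμ u + degμs B₂                   ≡⟨ cong (_+ degμs B₂) (degμ-lin t α B₁ u∈) ⟩
    (degμ t + degμs B₁) + degμs B₂      ≡⟨ +-assoc (degμ t) _ _ ⟩
    degμ t + (degμs B₁ + degμs B₂)      ≡⟨ cong (degμ t +_) (degμs-++ B₁ B₂) ⟨
    degμ t + degμs (B₁ ++ B₂)           ≡⟨ cong (degμ t +_) (degμs-↭ B↭) ⟨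
    degμ t + degμs B                    ∎
    where open ≡-Reasoning

  degμs-linBag : ∀ vs α Bs {c} → c ∈ linBag vs α Bs → degμs c ≡ degμs vs + degμs (concat Bs)
  degμs-linBag []       α []       (here refl) = refl
  degμs-linBag []       α []       (there ())
  degμs-linBag (v ∷ vs) α (B ∷ Bs) c∈ with ∈-cons*⁻ (lin v α B) (linBag vs α Bs) c∈
  ... | u , b , u∈ , b∈ , refl = begin
    degμ u + degμs b                                       ≡⟨ cong₂ _+_ (degμ-lin v α B u∈) (degμs-linBag vs α Bs b∈) ⟩
    (degμ v + degμs B) + (degμs vs + degμs (concat Bs))    ≡⟨ interchange (degμ v) _ _ _ ⟩
    (degμ v + degμs vs) + (degμs B + degμs (concat Bs))    ≡⟨ cong (degμs (v ∷ vs) +_) (degμs-++ B (concat Bs)) ⟨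
    degμs (v ∷ vs) + degμs (B ++ concat Bs)                ∎
    where open ≡-Reasoning

mutual
  bagDepths-lin : ∀ t α B {w} → w ∈ lin t α B → bagDepths t ⊆ₘ bagDepths w
  bagDepths-lin (var x) α [] (here refl) = ⊆ₘ-refl
  bagDepths-lin (var x) α [] (there ())
  bagDepths-lin (lam t) α B w∈ with ∈-map⁻ lam w∈
  ... | _ , w∈′ , refl = bagDepths-lin t α _ w∈′
  bagDepths-lin (mu η t) α B w∈ with ∈-map⁻ (uncurry mu) w∈
  ... | _ , p∈ , refl = ⊆ₘ-map suc (bagDepths-linNamed η t (suc α) _ p∈)
  bagDepths-lin (app t vs) α B w∈ with ∈-lin-app⁻ t vs α B w∈
  ... | B₀ , Bs , u , b , _ , u∈ , b∈ , refl =
    ⊆ₘ-∷⁺ 0 (⊆ₘ-++⁺ (bagDepths-lin t α B₀ u∈) (bagDepthss-linBag vs α Bs b∈))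

  bagDepths-linNamed : ∀ η t α B {η′ w} → (η′ , w) ∈ linNamed η t α B → bagDepths t ⊆ₘ bagDepths w
  bagDepths-linNamed η t α B p∈ with ∈-linNamed⁻ η t α B p∈
  ... | inj₁ w∈ = bagDepths-lin t α B w∈
  ... | inj₂ (B₁ , B₂ , u , _ , u∈ , refl) = ⊆ₘ-∷ʳ 0 (⊆ₘ-++ʳ (bagDepthss B₂) (bagDepths-lin t α B₁ u∈))

  bagDepthss-linBag : ∀ vs α Bs {c} → c ∈ linBag vs α Bs → bagDepthss vs ⊆ₘ bagDepthss c
  bagDepthss-linBag []       α []       (here refl) = ⊆ₘ-refl
  bagDepthss-linBag []       α []       (there ())
  bagDepthss-linBag (v ∷ vs) α (B ∷ Bs) c∈ with ∈-cons*⁻ (lin v α B) (linBag vs α Bs) c∈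
  ... | u , b , u∈ , b∈ , refl = ⊆ₘ-++⁺ (bagDepths-lin v α B u∈) (bagDepthss-linBag vs α Bs b∈)

degμ-⟶μr : ∀ {t S} → t ⟶μr S → ∀ {t′} → t′ ∈ S → degμ t′ ≡ degμ t
degμ-⟶μr (root β s B) t′∈ with ∈-map⁻ (uncurry mu) t′∈
... | _ , p∈ , refl = cong suc (trans (degμ-linNamed β s 0 _ p∈) (cong (degμ s +_) (degμs-shiftNs 0 B)))
degμ-⟶μr (lamC r) t′∈ with ∈-map⁻ lam t′∈
... | _ , u∈ , refl = degμ-⟶μr r u∈
degμ-⟶μr (appL B r) t′∈ with ∈-map⁻ (λ u → app u B) t′∈
... | _ , u∈ , refl = cong (_+ degμs B) (degμ-⟶μr r u∈)
degμ-⟶μr (appR t B₁ B₂ r) t′∈ with ∈-map⁻ (λ u → app t (B₁ ++ u ∷ B₂)) t′∈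
... | _ , u∈ , refl = cong (degμ t +_) (degμs-++-∷ B₁ B₂ (degμ-⟶μr r u∈))
degμ-⟶μr (muC β r) t′∈ with ∈-map⁻ (mu β) t′∈
... | _ , u∈ , refl = cong suc (degμ-⟶μr r u∈)

bagDepths-⟶μr : ∀ {t S} → t ⟶μr S → ∀ {t′} → t′ ∈ S → MultisetLt _>_ (bagDepths t′) (bagDepths t)
bagDepths-⟶μr (root β s B) t′∈ with ∈-map⁻ (uncurry mu) t′∈
... | _ , p∈ , refl with bagDepths-linNamed β s 0 _ p∈
...   | Y , w↭ =
  0 ∷ bagDepthss B , map suc Y , map suc (bagDepths s) ,
  ↭-trans (map⁺ suc w↭) (↭-reflexive (map-++ suc (bagDepths s) Y)) ,
  ↭-sym (shift 0 (map suc (bagDepths s)) (bagDepthss B)) , (λ ()) , deeper-than-redex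
  where
  deeper-than-redex : ∀ {y} → y ∈ map suc Y → ∃[ x ] (x ∈ 0 ∷ bagDepthss B × y > x)
  deeper-than-redex y∈ with ∈-map⁻ suc y∈
  ... | _ , _ , refl = 0 , here refl , s≤s z≤n
bagDepths-⟶μr (lamC r) t′∈ with ∈-map⁻ lam t′∈
... | _ , u∈ , refl = bagDepths-⟶μr r u∈
bagDepths-⟶μr (appL B r) t′∈ with ∈-map⁻ (λ u → app u B) t′∈
... | _ , u∈ , refl = multisetLt-++ˡ [ 0 ] (multisetLt-++ʳ (bagDepthss B) (bagDepths-⟶μr r u∈))
bagDepths-⟶μr (appR t B₁ B₂ r) t′∈ with ∈-map⁻ (λ u → app t (B₁ ++ u ∷ B₂)) t′∈
... | _ , u∈ , refl = multisetLt-++ˡ (0 ∷ bagDepths t) (bagDepthss-++-∷ B₁ B₂ (bagDepths-⟶μr r u∈))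
bagDepths-⟶μr (muC β r) t′∈ with ∈-map⁻ (mu β) t′∈
... | _ , u∈ , refl = multisetLt-map suc (λ _ → s≤s) (bagDepths-⟶μr r u∈)

proposition2p9 : (t t' : Term) (S : Sum) → t ⟶μr S → t' ∈ S → ms t' <ₘ ms t
proposition2p9 t t' S t⟶S t'∈S =
  subst (λ D → map (D ∸_) (bagDepths t') <ₘ ms t) (sym same-degμ)
        (multisetLt-map (degμ t ∸_) ∸-antitone (bagDepths-⟶μr t⟶S t'∈S))
  where
  same-degμ : degμ t' ≡ degμ t
  same-degμ = degμ-⟶μr t⟶S t'∈S

  ∸-antitone : ∀ {x y} → y ∈ bagDepths t' → y > x → degμ t ∸ y < degμ t ∸ x
  ∸-antitone y∈ x<y = ∸-monoʳ-< x<y (subst (_ ≤_) same-degμ (bagDepths-≤-degμ t' y∈))
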